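{- Let $X$ be a finite nonempty set of positive integers and let $\mathcal{G}_X$ be the nim sequence of the all-but subtraction game with finite excluded subtraction set $X$. Consider the following (infinite) procedure, which assigns values to nonnegative integers; initially no integer has an assigned value. For $k=0,1,2,\dots$ (stage $k$): let $n$ be the least nonnegative integer with no assigned value, and assign the value $k$ to $n$. Then, for each $x\in X$ considered in increasing order: if $n+x$ has no assigned value and every integer $m<n+x$ that has been assigned the value $k$ satisfies $(n+x)-m\in X$, assign the value $k$ to $n+x$. Then for every $k\geq 0$, the set of integers assigned the value $k$ during stage $k$ is exactly $\{m\geq 0:\mathcal{G}_X(m)=k\}$.
   Context: For a finite set $X$ of positive integers, the all-but subtraction game with finite excluded subtraction set $X$ is the subtraction game with subtraction set $S=\{1,2,3,\dots\}\setminus X$: a position is a heap of $n\geq 0$ counters, and a move removes $s$ counters for some $s\in S$ with $s\leq n$. Its nim sequence is defined by $\mathcal{G}_X(n)=\operatorname{mex}\{\mathcal{G}_X(n-s): s\in S,\ s\leq n\}$ for $n\geq 0$, where $\operatorname{mex}$ of a set of nonnegative integers is the least nonnegative integer not in it. -}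

module Defs where

open import Data.Nat using (ℕ; zero; suc; _+_; _∸_; _≡ᵇ_; _<ᵇ_)
open import Data.Bool using (Bool; true; false; if_then_else_; not; _∧_; _∨_)
open import Data.List using (List; []; _∷_; length)
open import Data.Bool.ListAction using (any; all)
open import Data.Product using (_×_; _,_)

memᵇ : ℕ → List ℕ → Bool
memᵇ y xs = any (λ x → y ≡ᵇ x) xs

-- mex of a finite list: least k not in the list (it is ≤ length l).

mexFrom : ℕ → ℕ → List ℕ → ℕ
mexFrom k zero    l = k
mexFrom k (suc f) l = if memᵇ k l then mexFrom (suc k) f l else k

mex : List ℕ → ℕ
mex l = mexFrom 0 (suc (length l)) l

-- Nim sequence of the all-but subtraction game, S = ℕ⁺ \ X.
-- hist X n = [ G(n-1) , G(n-2) , … , G(0) ].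
-- options X (hist X n) 1 = [ G(n-s) | 1 ≤ s ≤ n , s ∉ X ].

options : List ℕ → List ℕ → ℕ → List ℕ
options X []       s = []
options X (v ∷ vs) s =
  if memᵇ s X then options X vs (suc s) else v ∷ options X vs (suc s)

hist : List ℕ → ℕ → List ℕ
hist X zero    = []
hist X (suc n) = mex (options X (hist X n) 1) ∷ hist X n

G : List ℕ → ℕ → ℕ
G X n = mex (options X (hist X n) 1)

-- The stage procedure. An assignment state is a list of pairs
-- (integer , assigned value).

assignedᵇ : ℕ → List (ℕ × ℕ) → Bool
assignedᵇ y st = any (λ { (m , v) → y ≡ᵇ m }) st

-- least nonnegative integer with no assigned value
-- (fuel length st + 1 suffices since st is finite)
leastFreeFrom : ℕ → ℕ → List (ℕ × ℕ) → ℕ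
leastFreeFrom k zero    st = k
leastFreeFrom k (suc f) st =
  if assignedᵇ k st then leastFreeFrom (suc k) f st else k

leastFree : List (ℕ × ℕ) → ℕ
leastFree st = leastFreeFrom 0 (suc (length st)) st

okᵇ : List ℕ → ℕ → ℕ → List (ℕ × ℕ) → Bool
okᵇ X k y st =
  all (λ { (m , v) → not (v ≡ᵇ k) ∨ not (m <ᵇ y) ∨ memᵇ (y ∸ m) X }) st

-- Processing the elements of X (the last argument, in the given order)
-- during stage k with base n.  'new' = pairs assigned so far in this
-- stage, 'old' = pairs assigned in earlier stages.
stageLoop : List ℕ → ℕ → ℕ → List (ℕ × ℕ) → List (ℕ × ℕ) → List ℕ
          → List (ℕ × ℕ)
stageLoop X k n old new []       = new
stageLoop X k n old new (x ∷ xs) =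
  if not (assignedᵇ (n + x) new ∨ assignedᵇ (n + x) old)
     ∧ okᵇ X k (n + x) new ∧ okᵇ X k (n + x) old
  then stageLoop X k n old ((n + x , k) ∷ new) xs
  else stageLoop X k n old new xs

-- pairs assigned during stage k, given the state before stage k
-- (X is assumed listed in increasing order)
stageNew : List ℕ → ℕ → List (ℕ × ℕ) → List (ℕ × ℕ)
stageNew X k old = stageLoop X k n old ((n , k) ∷ []) X
  where n = leastFree old

stateBefore : List ℕ → ℕ → List (ℕ × ℕ)
stateBefore X zero    = []
stateBefore X (suc k) = stageNew X k (stateBefore X k) Data.List.++ stateBefore X k
  where import Data.List

stageSet : List ℕ → ℕ → List ℕ
stageSet X k = Data.List.map (λ { (m , v) → m }) (stageNew X k (stateBefore X k))
  where import Data.List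

-- Two positions of equal value differ by an element of X, for otherwise the larger could move to the
-- smaller. So if n is the least position of value k, the positions of value k are n and some of the
-- n + x with x ∈ X. Once stages 0, …, k - 1 have assigned exactly the positions of value < k, n is the
-- least unassigned position, and n + x is accepted exactly when its value is k: a smaller value means
-- it is already assigned, a larger one gives a move from n + x to a position of value k, which was accepted
-- earlier because X is processed in increasing order.

module Submission where

open import Defs
open import Data.Bool using (true; false; T; not; _∧_; _∨_; if_then_else_)
open import Data.Fin using (Fin)
open import Data.Fin.Properties using (pigeonhole; toℕ<n)
open import Data.List using (List; []; _∷_; length; lookup; map; _++_)
open import Data.List.Properties using (length-map; map-++)
open import Data.List.Relation.Unary.All as All using (All; []; _∷_)
open import Data.List.Relation.Unary.All.Properties using (all⁺; all⁻; ++⁺)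
open import Data.List.Relation.Unary.AllPairs using (AllPairs; _∷_)
open import Data.List.Relation.Unary.Any as Any using (here; there)
open import Data.List.Relation.Unary.Any.Properties using (any⁺; any⁻; lookup-index)
open import Data.List.Relation.Unary.Linked using (Linked)
open import Data.List.Relation.Unary.Linked.Properties using (Linked⇒AllPairs)
open import Data.List.Membership.Propositional using (_∈_; _∉_)
open import Data.List.Membership.Propositional.Properties using (∈-map⁺; ∈-map⁻; ∈-++⁺ˡ; ∈-++⁺ʳ; ∈-++⁻)
open import Data.Nat using (ℕ; zero; suc; _+_; _∸_; _≡ᵇ_; _<ᵇ_; _≤_; _<_)
open import Data.Nat.Properties
open import Data.List.Membership.DecPropositional _≟_ using (_∈?_)
open import Data.Product using (_×_; _,_; proj₁; proj₂; ∃-syntax)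
open import Data.Sum using (_⊎_; inj₁; inj₂)
open import Function using (_∘_)
open import Function.Bundles using (_⇔_; mk⇔; module Equivalence)
open Equivalence using (to; from)
open import Relation.Binary.Definitions using (tri<; tri≈; tri>)
open import Relation.Binary.PropositionalEquality using (_≡_; _≢_; refl; sym; trans; cong; subst)
open import Relation.Nullary using (¬_; yes; no; contradiction)
open import Relation.Nullary.Reflects using (Reflects; ofʸ; ofⁿ; fromEquivalence; ¬-reflects; _×-reflects_; _⊎-reflects_)

T-not-∨ : ∀ {a b} → T (not a ∨ b) ⇔ (T a → T b)
T-not-∨ {true}  = mk⇔ (λ tb _ → tb) (λ f → f _)
T-not-∨ {false} = mk⇔ (λ _ ()) (λ _ → _)

memᵇ⇔∈ : ∀ {y xs} → T (memᵇ y xs) ⇔ y ∈ xs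
memᵇ⇔∈ {y} {xs} = mk⇔
  (Any.map (λ {x} → ≡ᵇ⇒≡ y x) ∘ any⁻ _ xs)
  (any⁺ _ ∘ Any.map (λ {x} → ≡⇒≡ᵇ y x))

memᵇ-reflects : ∀ y xs → Reflects (y ∈ xs) (memᵇ y xs)
memᵇ-reflects y xs = fromEquivalence (to memᵇ⇔∈) (from memᵇ⇔∈)

all-below∈⇒≤length : ∀ {k} {l : List ℕ} → (∀ {j} → j < k → j ∈ l) → k ≤ length l
all-below∈⇒≤length {k} {l} below = ≮⇒≥ λ length<k →
  let i , j , i<j , same-index = pigeonhole length<k position in
  <-irrefl (trans (lookup-index (below (toℕ<n i)))
                  (trans (cong (lookup l) same-index)
                         (sym (lookup-index (below (toℕ<n j)))))) i<j
  where
  position : Fin k → Fin (length l)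
  position i = Any.index (below (toℕ<n i))

below-suc : ∀ {k} {l : List ℕ} → (∀ {j} → j < k → j ∈ l) → k ∈ l → ∀ {j} → j < suc k → j ∈ l
below-suc below k∈l j<1+k with m<1+n⇒m<n∨m≡n j<1+k
... | inj₁ j<k  = below j<k
... | inj₂ refl = k∈l

mexFrom-minimal : ∀ {k} f {l : List ℕ} → (∀ {j} → j < k → j ∈ l) → ∀ {j} → j < mexFrom k f l → j ∈ l
mexFrom-minimal zero below = below
mexFrom-minimal {k} (suc f) {l} below with memᵇ k l | memᵇ-reflects k l
... | true  | ofʸ k∈l = mexFrom-minimal f (below-suc below k∈l)
... | false | ofⁿ _   = below

-- The fuel suffices: were every j ≤ length l in l, pigeonhole would fail.
mexFrom-∉ : ∀ {k} f {l : List ℕ} → (∀ {j} → j < k → j ∈ l) → k + f ≡ suc (length l) → mexFrom k f l ∉ l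
mexFrom-∉ {k} zero {l} below k≡1+len _ =
  1+n≰n (subst (_≤ length l) (trans (sym (+-identityʳ k)) k≡1+len) (all-below∈⇒≤length below))
mexFrom-∉ {k} (suc f) {l} below k+f≡1+len with memᵇ k l | memᵇ-reflects k l
... | true  | ofʸ k∈l = mexFrom-∉ f (below-suc below k∈l) (trans (sym (+-suc k f)) k+f≡1+len)
... | false | ofⁿ k∉l = k∉l

mex-minimal : ∀ l {j} → j < mex l → j ∈ l
mex-minimal l = mexFrom-minimal (suc (length l)) (λ ())

mex-∉ : ∀ l → mex l ∉ l
mex-∉ l = mexFrom-∉ (suc (length l)) (λ ()) refl

keys : List (ℕ × ℕ) → List ℕ
keys = map proj₁

assignedᵇ≡memᵇ-keys : ∀ y st → assignedᵇ y st ≡ memᵇ y (keys st)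
assignedᵇ≡memᵇ-keys y []       = refl
assignedᵇ≡memᵇ-keys y (p ∷ st) = cong ((y ≡ᵇ proj₁ p) ∨_) (assignedᵇ≡memᵇ-keys y st)

assignedᵇ-reflects : ∀ y st → Reflects (y ∈ keys st) (assignedᵇ y st)
assignedᵇ-reflects y st = subst (Reflects _) (sym (assignedᵇ≡memᵇ-keys y st)) (memᵇ-reflects y (keys st))

leastFreeFrom≡mexFrom : ∀ k f st → leastFreeFrom k f st ≡ mexFrom k f (keys st)
leastFreeFrom≡mexFrom k zero    st = refl
leastFreeFrom≡mexFrom k (suc f) st rewrite assignedᵇ≡memᵇ-keys k st with memᵇ k (keys st)
... | true  = leastFreeFrom≡mexFrom (suc k) f st
... | false = refl

leastFree≡mex : ∀ st → leastFree st ≡ mex (keys st)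
leastFree≡mex st rewrite leastFreeFrom≡mexFrom 0 (suc (length st)) st | length-map proj₁ st = refl

module NimSequence (X : List ℕ) where

  -- In options X (hist X n) s the value G X m, for m < n, sits where s + n ∸ suc m counters are removed.
  OptionEntry : ℕ → ℕ → ℕ → Set
  OptionEntry n s v = ∃[ m ] m < n × s + n ∸ suc m ∉ X × G X m ≡ v

  removal-shift : ∀ s n m → suc s + n ∸ suc m ≡ s + suc n ∸ suc m
  removal-shift s n m = cong (_∸ suc m) (sym (+-suc s n))

  optionEntry-shift : ∀ {n s v} → OptionEntry n (suc s) v → OptionEntry (suc n) s v
  optionEntry-shift {n} {s} (m , m<n , ∉X , Gm≡v) =
    m , m<n⇒m<1+n m<n , subst (_∉ X) (removal-shift s n m) ∉X , Gm≡v

  ∈-options⁻ : ∀ n s {v} → v ∈ options X (hist X n) s → OptionEntry n s v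
  ∈-options⁻ (suc n) s v∈ with memᵇ s X | memᵇ-reflects s X
  ... | true  | ofʸ _   = optionEntry-shift (∈-options⁻ n (suc s) v∈)
  ... | false | ofⁿ s∉X with v∈
  ...   | here refl = n , n<1+n n , subst (_∉ X) (sym (m+n∸n≡m s (suc n))) s∉X , refl
  ...   | there v∈′ = optionEntry-shift (∈-options⁻ n (suc s) v∈′)

  ∈-options⁺ : ∀ n s {m} → m < n → s + n ∸ suc m ∉ X → G X m ∈ options X (hist X n) s
  ∈-options⁺ (suc n) s {m} m<1+n ∉X
    with memᵇ s X | memᵇ-reflects s X | m<1+n⇒m<n∨m≡n m<1+n
  ... | true  | ofʸ s∈X | inj₂ refl = contradiction s∈X (subst (_∉ X) (m+n∸n≡m s (suc n)) ∉X)
  ... | true  | ofʸ _   | inj₁ m<n  = ∈-options⁺ n (suc s) m<n (subst (_∉ X) (sym (removal-shift s n m)) ∉X)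
  ... | false | ofⁿ _   | inj₂ refl = here refl
  ... | false | ofⁿ _   | inj₁ m<n  = there (∈-options⁺ n (suc s) m<n (subst (_∉ X) (sym (removal-shift s n m)) ∉X))

  G-move-≢ : ∀ {m n} → m < n → n ∸ m ∉ X → G X m ≢ G X n
  G-move-≢ {m} {n} m<n ∉X Gm≡Gn =
    mex-∉ (options X (hist X n) 1) (subst (_∈ options X (hist X n) 1) Gm≡Gn (∈-options⁺ n 1 m<n ∉X))

  G-move-below : ∀ {n j} → j < G X n → ∃[ m ] m < n × n ∸ m ∉ X × G X m ≡ j
  G-move-below {n} j<Gn = ∈-options⁻ n 1 (mex-minimal (options X (hist X n) 1) j<Gn)

  G-≡⇒∸∈ : ∀ {m n} → m < n → G X m ≡ G X n → n ∸ m ∈ X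
  G-≡⇒∸∈ {m} {n} m<n Gm≡Gn with n ∸ m ∈? X
  ... | yes ∈X = ∈X
  ... | no  ∉X = contradiction Gm≡Gn (G-move-≢ m<n ∉X)

  G-≡-above : ∀ {n m} → n ≤ m → G X n ≡ G X m → m ≡ n ⊎ ∃[ z ] z ∈ X × m ≡ n + z
  G-≡-above n≤m Gn≡Gm with m≤n⇒m<n∨m≡n n≤m
  ... | inj₂ n≡m = inj₁ (sym n≡m)
  ... | inj₁ n<m = inj₂ (_ , G-≡⇒∸∈ n<m Gn≡Gm , sym (m+[n∸m]≡n n≤m))

Admissible : List ℕ → ℕ → ℕ → List (ℕ × ℕ) → Set
Admissible X k y st = ∀ {m v} → (m , v) ∈ st → v ≡ k → m < y → y ∸ m ∈ X

okᵇ-entry⇔ : ∀ {X k y m v} →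
             T (not (v ≡ᵇ k) ∨ not (m <ᵇ y) ∨ memᵇ (y ∸ m) X) ⇔ (v ≡ k → m < y → y ∸ m ∈ X)
okᵇ-entry⇔ {X} {k} {y} {m} {v} = mk⇔
  (λ t v≡k m<y → to memᵇ⇔∈ (to T-not-∨ (to T-not-∨ t (≡⇒≡ᵇ v k v≡k)) (<⇒<ᵇ m<y)))
  (λ h → from T-not-∨ λ v≡ᵇk → from T-not-∨ λ m<ᵇy →
     from memᵇ⇔∈ (h (≡ᵇ⇒≡ v k v≡ᵇk) (<ᵇ⇒< m y m<ᵇy)))

okᵇ-reflects : ∀ X k y st → Reflects (Admissible X k y st) (okᵇ X k y st)
okᵇ-reflects X k y st = fromEquivalence
  (λ t p → to okᵇ-entry⇔ (All.lookup (all⁺ _ st t) p))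
  (λ adm → all⁻ _ (All.tabulate (λ p → from okᵇ-entry⇔ (adm p))))

module StageProcedure (X : List ℕ) where
  open NimSequence X

  record Settled (k : ℕ) (st : List (ℕ × ℕ)) : Set where
    field
      assigned⇒G< : ∀ {m} → m ∈ keys st → G X m < k
      G<⇒assigned : ∀ {m} → G X m < k → m ∈ keys st
      values<     : All ((_< k) ∘ proj₂) st

  -- xs is the part of X not yet processed in the current stage.
  Pending : List ℕ → Set
  Pending xs = ∀ {z} → z ∈ X → z ∈ xs ⊎ All (z <_) xs

  Below : ℕ → List ℕ → ℕ → Set
  Below n xs m = All (λ x → m < n + x) xs

  record Invariant (k n : ℕ) (xs : List ℕ) (new : List (ℕ × ℕ)) : Set where
    field
      sound    : ∀ {m} → m ∈ keys new → G X m ≡ k × Below n xs m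
      complete : ∀ {m} → G X m ≡ k → Below n xs m → m ∈ keys new
      values≡  : All ((_≡ k) ∘ proj₂) new

  ∈-keys⇒pair : ∀ {k m st} → All ((_≡ k) ∘ proj₂) st → m ∈ keys st → (m , k) ∈ st
  ∈-keys⇒pair values≡ m∈ with ∈-map⁻ proj₁ m∈
  ... | (m , v) , p∈ , refl with All.lookup values≡ p∈
  ...   | refl = p∈

  pending-tail : ∀ {x xs} → All (x <_) xs → Pending (x ∷ xs) → Pending xs
  pending-tail x<xs pending z∈X with pending z∈X
  ... | inj₁ (here refl)  = inj₂ x<xs
  ... | inj₁ (there z∈xs) = inj₁ z∈xs
  ... | inj₂ (_ ∷ z<xs)   = inj₂ z<xs

  module Loop (k n : ℕ) (old : List (ℕ × ℕ)) (settled : Settled k old)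
              (Gn≡k : G X n ≡ k) (n-least : ∀ {m} → m < n → G X m < k) where
    open Settled settled

    level-k : ∀ {m} → G X m ≡ k → m ≡ n ⊎ ∃[ z ] z ∈ X × m ≡ n + z
    level-k Gm≡k = G-≡-above (≮⇒≥ λ m<n → <⇒≢ (n-least m<n) Gm≡k) (trans Gn≡k (sym Gm≡k))

    below-of-≤ : ∀ {x xs m} → All (x <_) xs → m ≤ n + x → Below n xs m
    below-of-≤ x<xs m≤n+x = All.map (λ x<x′ → ≤-<-trans m≤n+x (+-monoʳ-< n x<x′)) x<xs

    below-extend : ∀ {x xs m} → All (0 <_) (x ∷ xs) → Pending (x ∷ xs) →
                 G X m ≡ k → Below n xs m → m ≢ n + x → m < n + x
    below-extend {m = m} (x>0 ∷ _) pending Gm≡k below m≢y with level-k {m} Gm≡k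
    ... | inj₁ refl = m<m+n n x>0
    ... | inj₂ (z , z∈X , refl) with pending z∈X
    ...   | inj₁ (here refl)  = contradiction refl m≢y
    ...   | inj₁ (there z∈xs) = contradiction (All.lookup below z∈xs) (<-irrefl refl)
    ...   | inj₂ (z<x ∷ _)    = +-monoʳ-< n z<x

    Accepts : ℕ → List (ℕ × ℕ) → Set
    Accepts y new = ¬ (y ∈ keys new ⊎ y ∈ keys old) × Admissible X k y new × Admissible X k y old

    accepts-reflects : ∀ y new → Reflects (Accepts y new)
      (not (assignedᵇ y new ∨ assignedᵇ y old) ∧ okᵇ X k y new ∧ okᵇ X k y old)
    accepts-reflects y new =
      ¬-reflects (assignedᵇ-reflects y new ⊎-reflects assignedᵇ-reflects y old)
      ×-reflects okᵇ-reflects X k y new ×-reflects okᵇ-reflects X k y old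

    initial : All (0 <_) X → Invariant k n X ((n , k) ∷ [])
    initial pos = record
      { sound    = λ { (here refl) → Gn≡k , All.map (m<m+n n) pos }
      ; complete = complete′
      ; values≡  = refl ∷ []
      }
      where
      complete′ : ∀ {m} → G X m ≡ k → Below n X m → m ∈ n ∷ []
      complete′ {m} Gm≡k below with level-k {m} Gm≡k
      ... | inj₁ refl              = here refl
      ... | inj₂ (z , z∈X , refl) = contradiction (All.lookup below z∈X) (<-irrefl refl)

    module _ {x xs new} (x<xs : All (x <_) xs) (pos : All (0 <_) (x ∷ xs)) (pending : Pending (x ∷ xs))
             (inv : Invariant k n (x ∷ xs) new) where
      open Invariant inv

      accepts⇔G≡k : Accepts (n + x) new ⇔ G X (n + x) ≡ k
      accepts⇔G≡k = mk⇔ accepted⇒G≡k G≡k⇒accepted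
        where
        accepted⇒G≡k : Accepts (n + x) new → G X (n + x) ≡ k
        accepted⇒G≡k (unassigned , admissible , _) with <-cmp (G X (n + x)) k
        ... | tri< Gy<k _ _ = contradiction (inj₂ (G<⇒assigned Gy<k)) unassigned
        ... | tri≈ _ Gy≡k _ = Gy≡k
        ... | tri> _ _ Gy>k with G-move-below Gy>k
        ...   | m , m<y , ∉X , Gm≡k =
          contradiction (admissible (∈-keys⇒pair values≡ m∈new) refl m<y) ∉X
          where m∈new = complete Gm≡k (m<y ∷ below-of-≤ x<xs (<⇒≤ m<y))

        G≡k⇒accepted : G X (n + x) ≡ k → Accepts (n + x) new
        G≡k⇒accepted Gy≡k = unassigned , admissible-new , admissible-old
          where
          unassigned : ¬ (n + x ∈ keys new ⊎ n + x ∈ keys old)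
          unassigned (inj₁ y∈new) with sound y∈new
          ... | _ , y<y ∷ _ = <-irrefl refl y<y
          unassigned (inj₂ y∈old) = <⇒≢ (assigned⇒G< y∈old) Gy≡k
          admissible-new : Admissible X k (n + x) new
          admissible-new p∈ _ m<y = G-≡⇒∸∈ m<y (trans (proj₁ (sound (∈-map⁺ proj₁ p∈))) (sym Gy≡k))
          admissible-old : Admissible X k (n + x) old
          admissible-old p∈ v≡k _ = contradiction v≡k (<⇒≢ (All.lookup values< p∈))

      accept-step : G X (n + x) ≡ k → Invariant k n xs ((n + x , k) ∷ new)
      accept-step Gy≡k = record
        { sound    = λ { (here refl) → Gy≡k , below-of-≤ x<xs ≤-refl
                       ; (there m∈new) → proj₁ (sound m∈new) , All.tail (proj₂ (sound m∈new)) }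
        ; complete = complete′
        ; values≡  = refl ∷ values≡
        }
        where
        complete′ : ∀ {m} → G X m ≡ k → Below n xs m → m ∈ n + x ∷ keys new
        complete′ {m} Gm≡k below with m ≟ n + x
        ... | yes refl = here refl
        ... | no  m≢y  = there (complete Gm≡k (below-extend pos pending Gm≡k below m≢y ∷ below))

      reject-step : G X (n + x) ≢ k → Invariant k n xs new
      reject-step Gy≢k = record
        { sound    = λ m∈new → proj₁ (sound m∈new) , All.tail (proj₂ (sound m∈new))
        ; complete = λ {m} Gm≡k below →
            complete Gm≡k (below-extend pos pending Gm≡k below (λ { refl → Gy≢k Gm≡k }) ∷ below)
        ; values≡  = values≡
        }

    loop : ∀ xs new → AllPairs _<_ xs → All (0 <_) xs → Pending xs → Invariant k n xs new →
           Invariant k n [] (stageLoop X k n old new xs)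
    loop []       new _                 _   _       inv = inv
    loop (x ∷ xs) new (x<xs ∷ sorted) pos pending inv = decide (accepts-reflects (n + x) new)
      where
      pending′ : Pending xs
      pending′ = pending-tail x<xs pending
      decide : ∀ {b} → Reflects (Accepts (n + x) new) b →
               Invariant k n [] (if b then stageLoop X k n old ((n + x , k) ∷ new) xs
                                      else stageLoop X k n old new xs)
      decide (ofʸ accepted) = loop xs _ sorted (All.tail pos) pending′
        (accept-step x<xs pos pending inv (to (accepts⇔G≡k x<xs pos pending inv) accepted))
      decide (ofⁿ rejected) = loop xs new sorted (All.tail pos) pending′
        (reject-step x<xs pos pending inv (rejected ∘ from (accepts⇔G≡k x<xs pos pending inv)))

  stageNew-invariant : ∀ {k old} → AllPairs _<_ X → All (0 <_) X → Settled k old →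
                       Invariant k (leastFree old) [] (stageNew X k old)
  stageNew-invariant {k} {old} sorted pos settled =
    Loop.loop k n old settled Gn≡k n-least X ((n , k) ∷ []) sorted pos inj₁
      (Loop.initial k n old settled Gn≡k n-least pos)
    where
    open Settled settled
    n : ℕ
    n = leastFree old
    n-least : ∀ {m} → m < n → G X m < k
    n-least m<n = assigned⇒G< (mex-minimal (keys old) (subst (_ <_) (leastFree≡mex old) m<n))
    n-unassigned : n ∉ keys old
    n-unassigned = subst (_∉ keys old) (sym (leastFree≡mex old)) (mex-∉ (keys old))
    Gn≡k : G X n ≡ k
    Gn≡k with <-cmp (G X n) k
    ... | tri< Gn<k _ _ = contradiction (G<⇒assigned Gn<k) n-unassigned
    ... | tri≈ _ Gn≡k _ = Gn≡k
    ... | tri> _ _ Gn>k with G-move-below Gn>k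
    ...   | m , m<n , _ , Gm≡k = contradiction Gm≡k (<⇒≢ (n-least m<n))

  settled-++ : ∀ {k n old new} → Settled k old → Invariant k n [] new → Settled (suc k) (new ++ old)
  settled-++ {k} {old = old} {new} settled inv = record
    { assigned⇒G< = assigned⇒G<′
    ; G<⇒assigned = G<⇒assigned′
    ; values<     = ++⁺ (All.map (λ v≡k → ≤-reflexive (cong suc v≡k)) values≡) (All.map m<n⇒m<1+n values<)
    }
    where
    open Settled settled
    open Invariant inv
    assigned⇒G<′ : ∀ {m} → m ∈ keys (new ++ old) → G X m < suc k
    assigned⇒G<′ m∈ with ∈-++⁻ (keys new) (subst (_ ∈_) (map-++ proj₁ new old) m∈)
    ... | inj₁ m∈new = ≤-reflexive (cong suc (proj₁ (sound m∈new)))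
    ... | inj₂ m∈old = m<n⇒m<1+n (assigned⇒G< m∈old)
    G<⇒assigned′ : ∀ {m} → G X m < suc k → m ∈ keys (new ++ old)
    G<⇒assigned′ Gm<1+k = subst (_ ∈_) (sym (map-++ proj₁ new old)) (G<⇒assigned″ (m<1+n⇒m<n∨m≡n Gm<1+k))
      where
      G<⇒assigned″ : ∀ {m} → G X m < k ⊎ G X m ≡ k → m ∈ keys new ++ keys old
      G<⇒assigned″ (inj₁ Gm<k) = ∈-++⁺ʳ (keys new) (G<⇒assigned Gm<k)
      G<⇒assigned″ (inj₂ Gm≡k) = ∈-++⁺ˡ (complete Gm≡k [])

  settled-before : AllPairs _<_ X → All (0 <_) X → ∀ k → Settled k (stateBefore X k)
  settled-before sorted pos zero    = record { assigned⇒G< = λ () ; G<⇒assigned = λ () ; values< = [] }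
  settled-before sorted pos (suc k) =
    settled-++ (settled-before sorted pos k) (stageNew-invariant sorted pos (settled-before sorted pos k))

mainTheorem2 : (X : List ℕ) → X ≢ [] → All (0 <_) X → Linked _<_ X →
    (k m : ℕ) → (m ∈ stageSet X k) ⇔ (G X m ≡ k)
mainTheorem2 X _ pos linked k m = mk⇔ (proj₁ ∘ sound) (λ Gm≡k → complete Gm≡k [])
  where
  open StageProcedure X
  sorted : AllPairs _<_ X
  sorted = Linked⇒AllPairs <-trans linked
  open Invariant (stageNew-invariant sorted pos (settled-before sorted pos k))
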